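{- Let $G=(V,E)$ be a cycle with root $r\in V$ and $\mathcal C_G=\{C\subseteq V\setminus\{r\}:|\delta_E(C)|=2\}$. A family $\mathcal L\subseteq\mathcal C_G$ is a maximal laminar subfamily of $\mathcal C_G$ if and only if $\mathcal L$ is laminar and (1) $\{v\}\in\mathcal L$ for all $v\in V\setminus\{r\}$; (2) $V\setminus\{r\}\in\mathcal L$; (3) for every $C\in\mathcal L$ with $|C|>1$ there are $C_1,C_2\in\mathcal L$ with $C=C_1\,\dot\cup\, C_2$.
   Context: $\delta_E(C)$ is the set of edges of $E$ with exactly one endpoint in $C$. A family is laminar if any two of its members are disjoint or one contains the other. $\mathcal L\subseteq\mathcal C_G$ is a maximal laminar subfamily if it is laminar and there is no $C\in\mathcal C_G\setminus\mathcal L$ with $\mathcal L\cup\{C\}$ laminar. $C=C_1\,\dot\cup\,C_2$ denotes a disjoint union. -}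

module Defs where

open import Data.Nat using (ℕ; zero; suc; _+_; NonZero)
open import Data.Nat.DivMod using (_mod_)
open import Data.Bool using (Bool; true; false; if_then_else_; _xor_)
open import Data.Fin using (Fin; toℕ)
open import Data.Fin.Subset using (Subset; _∈_; _∉_; _⊆_; _∩_; _∪_; Empty; ⁅_⁆; ∁; ∣_∣)
open import Data.Fin.Permutation using (Permutation′; _⟨$⟩ʳ_)
open import Data.List using (List; map; allFin)
open import Data.Nat.ListAction using (sum)
open import Data.Vec using (lookup)
open import Data.Product using (_×_; Σ-syntax)
open import Data.Sum using (_⊎_)
open import Relation.Binary.PropositionalEquality using (_≡_)
open import Relation.Nullary using (¬_)

-- A cycle on vertex set Fin n (n ≥ 3) is given by a cyclic ordering
-- π : Fin n ≃ Fin n; its edges are e_i = {π i, π (i+1 mod n)}, i : Fin n.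
-- Every cycle on Fin n arises this way.

next : ∀ {n} .{{_ : NonZero n}} → Fin n → Fin n
next {n} i = suc (toℕ i) mod n

δ-size : ∀ {n} .{{_ : NonZero n}} → Permutation′ n → Subset n → ℕ
δ-size {n} π C =
  sum (map (λ i → if lookup C (π ⟨$⟩ʳ i) xor lookup C (π ⟨$⟩ʳ next i) then 1 else 0)
           (allFin n))

InCG : ∀ {n} .{{_ : NonZero n}} → Permutation′ n → Fin n → Subset n → Set
InCG π r C = (r ∉ C) × (δ-size π C ≡ 2)

Family : ℕ → Set
Family n = Subset n → Bool

_∈F_ : ∀ {n} → Subset n → Family n → Set
C ∈F 𝓛 = 𝓛 C ≡ true

-- A family viewed as a predicate, to allow 𝓛 ∪ {C}.
Pred : ℕ → Set₁
Pred n = Subset n → Set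

Disjoint : ∀ {n} → Subset n → Subset n → Set
Disjoint A B = Empty (A ∩ B)

Laminar : ∀ {n} → Pred n → Set
Laminar P = ∀ A B → P A → P B → Disjoint A B ⊎ (A ⊆ B ⊎ B ⊆ A)

asPred : ∀ {n} → Family n → Pred n
asPred 𝓛 C = C ∈F 𝓛

addTo : ∀ {n} → Family n → Subset n → Pred n
addTo 𝓛 C D = D ∈F 𝓛 ⊎ D ≡ C

SubfamilyOfCG : ∀ {n} .{{_ : NonZero n}} → Permutation′ n → Fin n → Family n → Set
SubfamilyOfCG π r 𝓛 = ∀ C → C ∈F 𝓛 → InCG π r C

MaximalLaminar : ∀ {n} .{{_ : NonZero n}} → Permutation′ n → Fin n → Family n → Set
MaximalLaminar π r 𝓛 =
  SubfamilyOfCG π r 𝓛 × Laminar (asPred 𝓛) ×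
  (∀ C → InCG π r C → ¬ (C ∈F 𝓛) → ¬ Laminar (addTo 𝓛 C))

Cond1 : ∀ {n} → Fin n → Family n → Set
Cond1 r 𝓛 = ∀ v → ¬ (v ≡ r) → ⁅ v ⁆ ∈F 𝓛

Cond2 : ∀ {n} → Fin n → Family n → Set
Cond2 r 𝓛 = ∁ ⁅ r ⁆ ∈F 𝓛

Cond3 : ∀ {n} → Family n → Set
Cond3 𝓛 = ∀ C → C ∈F 𝓛 → 1 Data.Nat.< ∣ C ∣ →
  Σ[ C₁ ∈ Subset _ ] Σ[ C₂ ∈ Subset _ ]
    (C₁ ∈F 𝓛) × (C₂ ∈F 𝓛) × Disjoint C₁ C₂ × (C ≡ C₁ ∪ C₂)

-- Singletons {v} (v ≠ r) and V ∖ {r} have two boundary edges and cross no member of 𝓛,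
-- so maximality puts them into 𝓛. For C ∈ 𝓛 with |C| > 1, take a vertex u ∈ C on an edge
-- leaving C and a maximal A ∈ 𝓛 with u ∈ A ⊊ C. Counting edge by edge gives
-- |δ(C ∖ A)| + 2 e(A, V ∖ C) = |δ(C)| + |δ(A)| = 4 with e(A, V ∖ C) ≥ 1 (the edge at u),
-- and |δ(C ∖ A)| ≠ 0 because the cycle is connected, C ∖ A ≠ ∅ and r ∉ C ∖ A;
-- hence C ∖ A ∈ 𝒞_G. Maximality of A keeps C ∖ A from crossing any member of 𝓛, so
-- C = A ∪̇ (C ∖ A) with both parts in 𝓛. Conversely, if C ∈ 𝒞_G ∖ 𝓛 crossed no member of 𝓛,
-- descend from V ∖ {r} along the splittings (3), always into the part containing C: the
-- descent terminates, and only at C itself, contradicting C ∉ 𝓛.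

module Submission where

open import Defs
import Algebra.Properties.CommutativeMonoid.Sum
open import Data.Bool using (Bool; true; false; if_then_else_; _xor_; not; _∧_; _∨_; f≤t; b≤b)
import Data.Bool as Bool
open import Data.Bool.Properties using (not-distribˡ-xor; not-distribʳ-xor; not-involutive; ∨-zeroʳ; ≤-minimum)
open import Data.Empty using (⊥; ⊥-elim)
open import Data.Fin using (Fin; zero; suc; toℕ; fromℕ; inject₁)
open import Data.Fin.Induction using (<-weakInduction)
open import Data.Fin.Permutation using (Permutation′; _⟨$⟩ʳ_; _⟨$⟩ˡ_; inverseˡ; inverseʳ)
open import Data.Fin.Properties using (toℕ-injective; toℕ-fromℕ<; toℕ-fromℕ; toℕ-inject₁; toℕ<n; ¬∀⟶∃¬; 0≢1+n)
open import Data.Fin.Relation.Unary.Top using (view; ‵fromℕ; ‵inject₁)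
open import Data.Fin.Subset using (Subset; _∈_; _∉_; _⊆_; _⊂_; _∩_; _∪_; ∁; ⁅_⁆; ∣_∣; Nonempty)
open import Data.Fin.Subset.Induction using (Acc; acc; ⊂-wellFounded; ⊃-wellFounded)
open import Data.Fin.Subset.Properties
  using (_∈?_; _⊂?_; anySubset?; x∈⁅x⁆; x∈⁅y⁆⇒x≡y; ∣⁅x⁆∣≡1; ⊆-antisym; ⊆-⊂-trans; p⊆q⇒∣p∣≤∣q∣;
         p⊂q⇒∣p∣<∣q∣; x∈p⇒x∉∁p; x∈∁p⇒x∉p; x∉p⇒x∈∁p; ∩-comm; p∩q⊆p; p∩q⊆q; x∈p∩q⁺; x∈p∩q⁻;
         ∪-comm; p⊆p∪q; q⊆p∪q; x∈p∪q⁻)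
open import Data.List using (map; allFin; tabulate)
open import Data.List.Properties using (map-tabulate)
open import Data.Nat using (ℕ; zero; suc; _+_; _%_; _≤_; _<_; _≟_; z≤n; s≤s; NonZero)
open import Data.Nat.DivMod using (m<n⇒m%n≡m; n%n≡0)
import Data.Nat.ListAction as List
open import Data.Nat.Properties
  using (+-0-commutativeMonoid; +-comm; +-cancelʳ-≡; +-mono-≤; m≤m+n; m+n≡0⇒m≡0; 1+n≢n; 1+n≢0; >⇒≢; <⇒≱)
open import Data.Product using (∃; _,_; _×_; proj₂)
open import Data.Sum using (_⊎_; inj₁; inj₂)
open import Data.Vec using (lookup; _∷_; [])
open import Data.Vec.Properties using ([]=⇒lookup; lookup⇒[]=; lookup-map; lookup-zipWith)
open import Function using (id; _∘_)
open import Function.Bundles using (_⇔_; mk⇔)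
open import Relation.Binary.PropositionalEquality
open import Relation.Nullary using (¬_; yes; no; contradiction)
open import Relation.Nullary.Decidable using (_×-dec_; decidable-stable)
open import Relation.Unary using (Decidable)

open Algebra.Properties.CommutativeMonoid.Sum +-0-commutativeMonoid
  using (sum-syntax; sum-cong-≗; sum-replicate-zero; sum-remove; sum-init-last; sum-permute; ∑-distrib-+)
  renaming (sum to ∑)

-- Sums over Fin

𝟙 : Bool → ℕ
𝟙 b = if b then 1 else 0

sum-map-allFin : ∀ {n} (f : Fin n → ℕ) → List.sum (map f (allFin n)) ≡ ∑[ i < n ] f i
sum-map-allFin f = trans (cong List.sum (map-tabulate id f)) (sum-tabulate f)
  where
  sum-tabulate : ∀ {m} (g : Fin m → ℕ) → List.sum (tabulate g) ≡ ∑[ i < m ] g i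
  sum-tabulate {zero}  g = refl
  sum-tabulate {suc m} g = cong (g zero +_) (sum-tabulate (g ∘ suc))

∑-𝟙-lookup : ∀ {n} (p : Subset n) → ∑[ x < n ] 𝟙 (lookup p x) ≡ ∣ p ∣
∑-𝟙-lookup []          = refl
∑-𝟙-lookup (true ∷ p)  = cong suc (∑-𝟙-lookup p)
∑-𝟙-lookup (false ∷ p) = ∑-𝟙-lookup p

∑≡0⇒≡0 : ∀ {n} (f : Fin (suc n) → ℕ) → ∑[ i < suc n ] f i ≡ 0 → ∀ i → f i ≡ 0
∑≡0⇒≡0 f ∑f≡0 i = m+n≡0⇒m≡0 (f i) (trans (sym (sum-remove f)) ∑f≡0)

≤∑ : ∀ {n} (f : Fin (suc n) → ℕ) i → f i ≤ ∑[ j < suc n ] f j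
≤∑ f i = subst (f i ≤_) (sym (sum-remove f)) (m≤m+n (f i) _)

∑≢0⇒∃≢0 : ∀ {n} (f : Fin n → ℕ) → ∑[ i < n ] f i ≢ 0 → ∃ λ i → f i ≢ 0
∑≢0⇒∃≢0 {n} f ∑f≢0 = ¬∀⟶∃¬ n (λ i → f i ≡ 0) (λ i → f i ≟ 0)
  (λ all≡0 → ∑f≢0 (trans (sum-cong-≗ all≡0) (sum-replicate-zero n)))

-- The cyclic successor

toℕ-next : ∀ {n} (i : Fin (suc n)) → toℕ (next i) ≡ suc (toℕ i) % suc n
toℕ-next i = toℕ-fromℕ< _

next-inject₁ : ∀ {n} (i : Fin n) → next (inject₁ i) ≡ suc i
next-inject₁ {n} i = toℕ-injective (begin
  toℕ (next (inject₁ i))        ≡⟨ toℕ-next (inject₁ i) ⟩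
  suc (toℕ (inject₁ i)) % suc n ≡⟨ cong (λ k → suc k % suc n) (toℕ-inject₁ i) ⟩
  suc (toℕ i) % suc n           ≡⟨ m<n⇒m%n≡m (s≤s (toℕ<n i)) ⟩
  suc (toℕ i)                   ∎)
  where open ≡-Reasoning

next-fromℕ : ∀ n → next (fromℕ n) ≡ zero
next-fromℕ n = toℕ-injective (trans (toℕ-next (fromℕ n))
  (trans (cong (λ k → suc k % suc n) (toℕ-fromℕ n)) (n%n≡0 (suc n))))

next-≢ : ∀ {n} .{{_ : NonZero n}} (i : Fin (suc n)) → next i ≢ i
next-≢ {suc n} i with view i
... | ‵fromℕ     = λ eq → 0≢1+n (trans (sym (next-fromℕ (suc n))) eq)
... | ‵inject₁ j = λ eq → 1+n≢n (trans (cong toℕ (trans (sym (next-inject₁ j)) eq)) (toℕ-inject₁ j))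

∑-next : ∀ {n} (g : Fin (suc n) → ℕ) → ∑[ i < suc n ] g (next i) ≡ ∑[ i < suc n ] g i
∑-next {n} g = begin
  ∑[ i < suc n ] g (next i)                            ≡⟨ sum-init-last (g ∘ next) ⟩
  ∑[ i < n ] g (next (inject₁ i)) + g (next (fromℕ n)) ≡⟨ cong₂ _+_ (sum-cong-≗ (cong g ∘ next-inject₁))
                                                                     (cong g (next-fromℕ n)) ⟩
  ∑[ i < n ] g (suc i) + g zero                        ≡⟨ +-comm _ (g zero) ⟩
  ∑[ i < suc n ] g i                                   ∎
  where open ≡-Reasoning

next-invariant⇒constant : ∀ {n} {A : Set} (f : Fin (suc n) → A) →
  (∀ i → f (next i) ≡ f i) → ∀ i → f i ≡ f zero
next-invariant⇒constant f invariant = <-weakInduction (λ i → f i ≡ f zero) refl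
  (λ i fi≡f0 → trans (cong f (sym (next-inject₁ i))) (trans (invariant (inject₁ i)) fi≡f0))

-- Cuts of the cycle

not-xor-not : ∀ a b → not a xor not b ≡ a xor b
not-xor-not a b = begin
  not a xor not b     ≡⟨ not-distribˡ-xor a (not b) ⟨
  not (a xor not b)   ≡⟨ cong not (not-distribʳ-xor a b) ⟨
  not (not (a xor b)) ≡⟨ not-involutive (a xor b) ⟩
  a xor b             ∎
  where open ≡-Reasoning

𝟙-xor : ∀ a b → (a ≡ true → b ≡ true → ⊥) → 𝟙 (a xor b) ≡ 𝟙 a + 𝟙 b
𝟙-xor true  true  not-both = ⊥-elim (not-both refl refl)
𝟙-xor true  false _ = refl
𝟙-xor false b     _ = refl

𝟙-xor≡0⇒≡ : ∀ a b → 𝟙 (a xor b) ≡ 0 → b ≡ a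
𝟙-xor≡0⇒≡ true  true  _ = refl
𝟙-xor≡0⇒≡ false false _ = refl

𝟙-xor≢0-cases : ∀ a b → 𝟙 (a xor b) ≢ 0 → (a ≡ true × b ≡ false) ⊎ (a ≡ false × b ≡ true)
𝟙-xor≢0-cases true  true  h = ⊥-elim (h refl)
𝟙-xor≢0-cases true  false _ = inj₁ (refl , refl)
𝟙-xor≢0-cases false true  _ = inj₂ (refl , refl)
𝟙-xor≢0-cases false false h = ⊥-elim (h refl)

-- The contribution of one edge pq to δ(C ∖ A) + 2 e(A, V ∖ C) = δ(C) + δ(A) for A ⊆ C,
-- where a = [p ∈ A], c = [p ∈ C], a' = [q ∈ A], c' = [q ∈ C].
crossing-difference : ∀ {a c a' c'} → a Bool.≤ c → a' Bool.≤ c' →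
  let leaves = 𝟙 ((a ∧ not c') ∨ (a' ∧ not c)) in
  𝟙 ((c ∧ not a) xor (c' ∧ not a')) + (leaves + leaves) ≡ 𝟙 (c xor c') + 𝟙 (a xor a')
crossing-difference f≤t f≤t = refl
crossing-difference f≤t (b≤b {false}) = refl
crossing-difference f≤t (b≤b {true}) = refl
crossing-difference (b≤b {false}) f≤t = refl
crossing-difference (b≤b {false}) (b≤b {false}) = refl
crossing-difference (b≤b {false}) (b≤b {true}) = refl
crossing-difference (b≤b {true}) f≤t = refl
crossing-difference (b≤b {true}) (b≤b {false}) = refl
crossing-difference (b≤b {true}) (b≤b {true}) = refl

lookup-∩∁ : ∀ {n} (C A : Subset n) x → lookup (C ∩ ∁ A) x ≡ lookup C x ∧ not (lookup A x)
lookup-∩∁ C A x = trans (lookup-zipWith _∧_ x C (∁ A)) (cong (lookup C x ∧_) (lookup-map x not A))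

⊆⇒lookup-≤ : ∀ {n} {A C : Subset n} → A ⊆ C → ∀ x → lookup A x Bool.≤ lookup C x
⊆⇒lookup-≤ {A = A} {C} A⊆C x with lookup A x in x∈A
... | false = ≤-minimum (lookup C x)
... | true  rewrite []=⇒lookup (A⊆C (lookup⇒[]= x A x∈A)) = b≤b

module _ {n : ℕ} (π : Permutation′ (suc n)) where

  private
    vertex : Fin (suc n) → Fin (suc n)
    vertex i = π ⟨$⟩ʳ i

    vertex-injective : ∀ {i j} → vertex i ≡ vertex j → i ≡ j
    vertex-injective eq = trans (sym (inverseˡ π)) (trans (cong (π ⟨$⟩ˡ_) eq) (inverseˡ π))

  crosses : Subset (suc n) → Fin (suc n) → Bool
  crosses S i = lookup S (vertex i) xor lookup S (vertex (next i))

  δ-size≡∑ : ∀ S → δ-size π S ≡ ∑[ i < suc n ] 𝟙 (crosses S i)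
  δ-size≡∑ S = sum-map-allFin (𝟙 ∘ crosses S)

  δ-size-∁ : ∀ S → δ-size π (∁ S) ≡ δ-size π S
  δ-size-∁ S = begin
    δ-size π (∁ S)                     ≡⟨ δ-size≡∑ (∁ S) ⟩
    ∑[ i < suc n ] 𝟙 (crosses (∁ S) i) ≡⟨ sum-cong-≗ (cong 𝟙 ∘ crosses-∁) ⟩
    ∑[ i < suc n ] 𝟙 (crosses S i)     ≡⟨ δ-size≡∑ S ⟨
    δ-size π S                         ∎
    where
    open ≡-Reasoning
    crosses-∁ : ∀ i → crosses (∁ S) i ≡ crosses S i
    crosses-∁ i rewrite lookup-map (vertex i) not S | lookup-map (vertex (next i)) not S =
      not-xor-not (lookup S (vertex i)) (lookup S (vertex (next i)))

  δ-size-⁅⁆ : .{{_ : NonZero n}} → ∀ v → δ-size π ⁅ v ⁆ ≡ 2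
  δ-size-⁅⁆ v = begin
    δ-size π ⁅ v ⁆
      ≡⟨ δ-size≡∑ ⁅ v ⁆ ⟩
    ∑[ i < suc n ] 𝟙 (crosses ⁅ v ⁆ i)
      ≡⟨ sum-cong-≗ crosses-⁅⁆ ⟩
    ∑[ i < suc n ] (χ (vertex i) + χ (vertex (next i)))
      ≡⟨ ∑-distrib-+ (χ ∘ vertex) (χ ∘ vertex ∘ next) ⟩
    ∑[ i < suc n ] χ (vertex i) + ∑[ i < suc n ] χ (vertex (next i))
      ≡⟨ cong (∑[ i < suc n ] χ (vertex i) +_) (∑-next (χ ∘ vertex)) ⟩
    ∑[ i < suc n ] χ (vertex i) + ∑[ i < suc n ] χ (vertex i)
      ≡⟨ cong₂ _+_ ∑χ≡1 ∑χ≡1 ⟩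
    2
      ∎
    where
    open ≡-Reasoning
    χ : Fin (suc n) → ℕ
    χ x = 𝟙 (lookup ⁅ v ⁆ x)
    ∈⁅v⁆ : ∀ {x} → lookup ⁅ v ⁆ x ≡ true → x ≡ v
    ∈⁅v⁆ {x} eq = x∈⁅y⁆⇒x≡y v (lookup⇒[]= x ⁅ v ⁆ eq)
    crosses-⁅⁆ : ∀ i → 𝟙 (crosses ⁅ v ⁆ i) ≡ χ (vertex i) + χ (vertex (next i))
    crosses-⁅⁆ i = 𝟙-xor _ _ λ i∈ next-i∈ →
      next-≢ i (sym (vertex-injective (trans (∈⁅v⁆ i∈) (sym (∈⁅v⁆ next-i∈)))))
    ∑χ≡1 : ∑[ i < suc n ] χ (vertex i) ≡ 1
    ∑χ≡1 = trans (sym (sum-permute χ π)) (trans (∑-𝟙-lookup ⁅ v ⁆) (∣⁅x⁆∣≡1 v))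

  ∈∧∉⇒δ-size≢0 : ∀ {S x y} → x ∈ S → y ∉ S → δ-size π S ≢ 0
  ∈∧∉⇒δ-size≢0 {S} {x} {y} x∈S y∉S δ≡0 =
    y∉S (lookup⇒[]= y S (trans (on-vertex y) (trans (sym (on-vertex x)) ([]=⇒lookup x∈S))))
    where
    f : Fin (suc n) → Bool
    f i = lookup S (vertex i)
    f-invariant : ∀ i → f (next i) ≡ f i
    f-invariant i =
      𝟙-xor≡0⇒≡ (f i) (f (next i)) (∑≡0⇒≡0 (𝟙 ∘ crosses S) (trans (sym (δ-size≡∑ S)) δ≡0) i)
    on-vertex : ∀ z → lookup S z ≡ f zero
    on-vertex z =
      trans (cong (lookup S) (sym (inverseʳ π))) (next-invariant⇒constant f f-invariant (π ⟨$⟩ˡ z))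

  leavesFrom : Subset (suc n) → Subset (suc n) → Fin (suc n) → Bool
  leavesFrom A C i = (lookup A (vertex i) ∧ not (lookup C (vertex (next i))))
                   ∨ (lookup A (vertex (next i)) ∧ not (lookup C (vertex i)))

  edgesLeaving : Subset (suc n) → Subset (suc n) → ℕ
  edgesLeaving A C = ∑[ i < suc n ] 𝟙 (leavesFrom A C i)

  leavesFrom⇒0<edgesLeaving : ∀ A C i → leavesFrom A C i ≡ true → 0 < edgesLeaving A C
  leavesFrom⇒0<edgesLeaving A C i leaves =
    subst (λ b → 𝟙 b ≤ edgesLeaving A C) leaves (≤∑ (𝟙 ∘ leavesFrom A C) i)

  δ-size≢0⇒boundary-vertex : ∀ {C} → δ-size π C ≢ 0 →
    ∃ λ u → u ∈ C × ∀ A → u ∈ A → 0 < edgesLeaving A C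
  δ-size≢0⇒boundary-vertex {C} δ≢0 with ∑≢0⇒∃≢0 (𝟙 ∘ crosses C) (δ≢0 ∘ trans (δ-size≡∑ C))
  ... | i , crosses≢0 with 𝟙-xor≢0-cases (lookup C (vertex i)) (lookup C (vertex (next i))) crosses≢0
  ... | inj₁ (u∈C , w∉C) = vertex i , lookup⇒[]= _ C u∈C ,
    λ A u∈A → leavesFrom⇒0<edgesLeaving A C i (leaves-here A u∈A)
    where
    leaves-here : ∀ A → vertex i ∈ A → leavesFrom A C i ≡ true
    leaves-here A u∈A rewrite []=⇒lookup u∈A | w∉C = refl
  ... | inj₂ (w∉C , u∈C) = vertex (next i) , lookup⇒[]= _ C u∈C ,
    λ A u∈A → leavesFrom⇒0<edgesLeaving A C i (leaves-here A u∈A)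
    where
    leaves-here : ∀ A → vertex (next i) ∈ A → leavesFrom A C i ≡ true
    leaves-here A u∈A rewrite []=⇒lookup u∈A | w∉C = ∨-zeroʳ _

  δ-size-difference : ∀ {A C} → A ⊆ C →
    δ-size π (C ∩ ∁ A) + (edgesLeaving A C + edgesLeaving A C) ≡ δ-size π C + δ-size π A
  δ-size-difference {A} {C} A⊆C = begin
    δ-size π (C ∩ ∁ A) + (edgesLeaving A C + edgesLeaving A C)
      ≡⟨ cong₂ _+_ (δ-size≡∑ (C ∩ ∁ A)) (sym (∑-distrib-+ leaves leaves)) ⟩
    ∑[ i < suc n ] 𝟙 (crosses (C ∩ ∁ A) i) + ∑[ i < suc n ] (leaves i + leaves i)
      ≡⟨ ∑-distrib-+ (𝟙 ∘ crosses (C ∩ ∁ A)) (λ i → leaves i + leaves i) ⟨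
    ∑[ i < suc n ] (𝟙 (crosses (C ∩ ∁ A) i) + (leaves i + leaves i))
      ≡⟨ sum-cong-≗ per-edge ⟩
    ∑[ i < suc n ] (𝟙 (crosses C i) + 𝟙 (crosses A i))
      ≡⟨ ∑-distrib-+ (𝟙 ∘ crosses C) (𝟙 ∘ crosses A) ⟩
    ∑[ i < suc n ] 𝟙 (crosses C i) + ∑[ i < suc n ] 𝟙 (crosses A i)
      ≡⟨ cong₂ _+_ (δ-size≡∑ C) (δ-size≡∑ A) ⟨
    δ-size π C + δ-size π A
      ∎
    where
    open ≡-Reasoning
    leaves : Fin (suc n) → ℕ
    leaves i = 𝟙 (leavesFrom A C i)
    per-edge : ∀ i → 𝟙 (crosses (C ∩ ∁ A) i) + (leaves i + leaves i) ≡ 𝟙 (crosses C i) + 𝟙 (crosses A i)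
    per-edge i rewrite lookup-∩∁ C A (vertex i) | lookup-∩∁ C A (vertex (next i)) =
      crossing-difference (⊆⇒lookup-≤ A⊆C (vertex i)) (⊆⇒lookup-≤ A⊆C (vertex (next i)))

-- Laminar families of subsets

NonCrossing : ∀ {n} → Subset n → Subset n → Set
NonCrossing A B = Disjoint A B ⊎ (A ⊆ B ⊎ B ⊆ A)

NonCrossing-sym : ∀ {n} {A B : Subset n} → NonCrossing A B → NonCrossing B A
NonCrossing-sym (inj₁ A∩B=∅) = inj₁ λ (x , x∈B∩A) → A∩B=∅ (x , subst (x ∈_) (∩-comm _ _) x∈B∩A)
NonCrossing-sym (inj₂ (inj₁ A⊆B)) = inj₂ (inj₂ A⊆B)
NonCrossing-sym (inj₂ (inj₂ B⊆A)) = inj₂ (inj₁ B⊆A)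

⁅⁆-NonCrossing : ∀ {n} (v : Fin n) D → NonCrossing ⁅ v ⁆ D
⁅⁆-NonCrossing v D with v ∈? D
... | yes v∈D = inj₂ (inj₁ λ x∈⁅v⁆ → subst (_∈ D) (sym (x∈⁅y⁆⇒x≡y v x∈⁅v⁆)) v∈D)
... | no  v∉D = inj₁ λ (x , x∈⁅v⁆∩D) → let x∈⁅v⁆ , x∈D = x∈p∩q⁻ ⁅ v ⁆ D x∈⁅v⁆∩D in
                                       v∉D (subst (_∈ D) (x∈⁅y⁆⇒x≡y v x∈⁅v⁆) x∈D)

Laminar-addTo : ∀ {n} {𝓛 : Family n} {C} → Laminar (asPred 𝓛) →
  (∀ D → D ∈F 𝓛 → NonCrossing C D) → Laminar (addTo 𝓛 C)
Laminar-addTo laminar noncrossing A B (inj₁ A∈𝓛) (inj₁ B∈𝓛) = laminar A B A∈𝓛 B∈𝓛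
Laminar-addTo laminar noncrossing A B (inj₁ A∈𝓛) (inj₂ refl) = NonCrossing-sym (noncrossing A A∈𝓛)
Laminar-addTo laminar noncrossing A B (inj₂ refl) (inj₁ B∈𝓛) = noncrossing B B∈𝓛
Laminar-addTo laminar noncrossing A B (inj₂ refl) (inj₂ refl) = inj₂ (inj₁ λ x∈A → x∈A)

⊆∧⊄⇒⊇ : ∀ {n} {A B : Subset n} → A ⊆ B → ¬ A ⊂ B → B ⊆ A
⊆∧⊄⇒⊇ {A = A} A⊆B A⊄B {x} x∈B with x ∈? A
... | yes x∈A = x∈A
... | no  x∉A = ⊥-elim (A⊄B (A⊆B , x , x∈B , x∉A))

x∈p⇒⁅x⁆⊆p : ∀ {n} {x : Fin n} {p} → x ∈ p → ⁅ x ⁆ ⊆ p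
x∈p⇒⁅x⁆⊆p {x = x} {p} x∈p y∈⁅x⁆ = subst (_∈ p) (sym (x∈⁅y⁆⇒x≡y x y∈⁅x⁆)) x∈p

⁅x⁆⊂p⇒1<∣p∣ : ∀ {n} {x : Fin n} {p} → ⁅ x ⁆ ⊂ p → 1 < ∣ p ∣
⁅x⁆⊂p⇒1<∣p∣ {x = x} {p} ⁅x⁆⊂p = subst (_< ∣ p ∣) (∣⁅x⁆∣≡1 x) (p⊂q⇒∣p∣<∣q∣ ⁅x⁆⊂p)

x∈p∧1<∣p∣⇒⁅x⁆⊂p : ∀ {n} {x : Fin n} {p} → x ∈ p → 1 < ∣ p ∣ → ⁅ x ⁆ ⊂ p
x∈p∧1<∣p∣⇒⁅x⁆⊂p {x = x} {p} x∈p 1<∣p∣ with ⁅ x ⁆ ⊂? p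
... | yes ⁅x⁆⊂p = ⁅x⁆⊂p
... | no  ⁅x⁆⊄p = contradiction
  (subst (∣ p ∣ ≤_) (∣⁅x⁆∣≡1 x) (p⊆q⇒∣p∣≤∣q∣ (⊆∧⊄⇒⊇ (x∈p⇒⁅x⁆⊆p x∈p) ⁅x⁆⊄p))) (<⇒≱ 1<∣p∣)

⊂-maximal : ∀ {n} {Q : Subset n → Set} → Decidable Q →
  ∀ {A} → Q A → ∃ λ B → Q B × ∀ D → Q D → ¬ B ⊂ D
⊂-maximal {Q = Q} Q? = go (⊃-wellFounded _)
  where
  go : ∀ {A} → Acc _ A → Q A → ∃ λ B → Q B × ∀ D → Q D → ¬ B ⊂ D
  go {A} (acc larger) QA with anySubset? (λ D → Q? D ×-dec (A ⊂? D))
  ... | yes (D , QD , A⊂D) = go (larger A⊂D) QD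
  ... | no  ∄D             = A , QA , λ D QD A⊂D → ∄D (D , QD , A⊂D)

⊆∪∧Disjoint⇒⊆ˡ : ∀ {n} {C D₁ D₂ : Subset n} → C ⊆ D₁ ∪ D₂ → Disjoint C D₂ → C ⊆ D₁
⊆∪∧Disjoint⇒⊆ˡ {D₁ = D₁} {D₂} C⊆D C∩D₂=∅ {x} x∈C with x∈p∪q⁻ D₁ D₂ (C⊆D x∈C)
... | inj₁ x∈D₁ = x∈D₁
... | inj₂ x∈D₂ = ⊥-elim (C∩D₂=∅ (x , x∈p∩q⁺ (x∈C , x∈D₂)))

⊆∪∧Disjoint⇒⊆ʳ : ∀ {n} {C D₁ D₂ : Subset n} → C ⊆ D₁ ∪ D₂ → Disjoint C D₁ → C ⊆ D₂
⊆∪∧Disjoint⇒⊆ʳ {D₁ = D₁} {D₂} C⊆D = ⊆∪∧Disjoint⇒⊆ˡ (subst (_ ∈_) (∪-comm D₁ D₂) ∘ C⊆D)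

C⊆D₁∨C⊆D₂ : ∀ {n} {C D₁ D₂ : Subset n} → Nonempty C → C ⊂ D₁ ∪ D₂ →
  NonCrossing C D₁ → NonCrossing C D₂ → C ⊆ D₁ ⊎ C ⊆ D₂
C⊆D₁∨C⊆D₂ _ _ (inj₂ (inj₁ C⊆D₁)) _ = inj₁ C⊆D₁
C⊆D₁∨C⊆D₂ _ _ _ (inj₂ (inj₁ C⊆D₂)) = inj₂ C⊆D₂
C⊆D₁∨C⊆D₂ {D₁ = D₁} {D₂} (x , x∈C) (C⊆D , _) (inj₁ C∩D₁=∅) (inj₁ C∩D₂=∅)
  with x∈p∪q⁻ D₁ D₂ (C⊆D x∈C)
... | inj₁ x∈D₁ = ⊥-elim (C∩D₁=∅ (x , x∈p∩q⁺ (x∈C , x∈D₁)))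
... | inj₂ x∈D₂ = ⊥-elim (C∩D₂=∅ (x , x∈p∩q⁺ (x∈C , x∈D₂)))
C⊆D₁∨C⊆D₂ {D₁ = D₁} {D₂} _ (_ , z , z∈D , z∉C) (inj₂ (inj₂ D₁⊆C)) (inj₂ (inj₂ D₂⊆C))
  with x∈p∪q⁻ D₁ D₂ z∈D
... | inj₁ z∈D₁ = ⊥-elim (z∉C (D₁⊆C z∈D₁))
... | inj₂ z∈D₂ = ⊥-elim (z∉C (D₂⊆C z∈D₂))
C⊆D₁∨C⊆D₂ _ (C⊆D , _) (inj₂ (inj₂ _)) (inj₁ C∩D₂=∅) = inj₁ (⊆∪∧Disjoint⇒⊆ˡ C⊆D C∩D₂=∅)
C⊆D₁∨C⊆D₂ _ (C⊆D , _) (inj₁ C∩D₁=∅) (inj₂ (inj₂ _)) = inj₂ (⊆∪∧Disjoint⇒⊆ʳ C⊆D C∩D₁=∅)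

p⊂p∪q : ∀ {n} {p q : Subset n} → Disjoint p q → Nonempty q → p ⊂ p ∪ q
p⊂p∪q {p = p} {q} p∩q=∅ (y , y∈q) =
  p⊆p∪q q , y , q⊆p∪q p q y∈q , λ y∈p → p∩q=∅ (y , x∈p∩q⁺ (y∈p , y∈q))

q⊂p∪q : ∀ {n} {p q : Subset n} → Disjoint p q → Nonempty p → q ⊂ p ∪ q
q⊂p∪q {p = p} {q} p∩q=∅ (y , y∈p) =
  q⊆p∪q p q , y , p⊆p∪q q y∈p , λ y∈q → p∩q=∅ (y , x∈p∩q⁺ (y∈p , y∈q))

splitting⇒closed : ∀ {n} {𝓛 : Family n} → (∀ D → D ∈F 𝓛 → Nonempty D) → Cond3 𝓛 →
  ∀ {C} → Nonempty C → (∀ D → D ∈F 𝓛 → NonCrossing C D) →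
  ∀ {D} → D ∈F 𝓛 → C ⊆ D → C ∈F 𝓛
splitting⇒closed {𝓛 = 𝓛} nonempty splitting {C} (x , x∈C) noncrossing = go (⊂-wellFounded _)
  where
  go : ∀ {D} → Acc _⊂_ D → D ∈F 𝓛 → C ⊆ D → C ∈F 𝓛
  go {D} (acc smaller) D∈𝓛 C⊆D with C ⊂? D
  ... | no  C⊄D = subst (_∈F 𝓛) (⊆-antisym (⊆∧⊄⇒⊇ C⊆D C⊄D) C⊆D) D∈𝓛
  ... | yes C⊂D with splitting D D∈𝓛 (⁅x⁆⊂p⇒1<∣p∣ (⊆-⊂-trans (x∈p⇒⁅x⁆⊆p x∈C) C⊂D))
  ...   | D₁ , D₂ , D₁∈𝓛 , D₂∈𝓛 , D₁∩D₂=∅ , refl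
    with C⊆D₁∨C⊆D₂ (x , x∈C) C⊂D (noncrossing D₁ D₁∈𝓛) (noncrossing D₂ D₂∈𝓛)
  ... | inj₁ C⊆D₁ = go (smaller (p⊂p∪q D₁∩D₂=∅ (nonempty D₂ D₂∈𝓛))) D₁∈𝓛 C⊆D₁
  ... | inj₂ C⊆D₂ = go (smaller (q⊂p∪q D₁∩D₂=∅ (nonempty D₁ D₁∈𝓛))) D₂∈𝓛 C⊆D₂

∖-Disjoint-⊆ : ∀ {n} {A C D : Subset n} → D ⊆ A → Disjoint (C ∩ ∁ A) D
∖-Disjoint-⊆ {A = A} {C} {D} D⊆A (x , x∈B∩D) =
  x∈∁p⇒x∉p (p∩q⊆q C (∁ A) (p∩q⊆p (C ∩ ∁ A) D x∈B∩D)) (D⊆A (p∩q⊆q (C ∩ ∁ A) D x∈B∩D))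

Disjoint-∖ : ∀ {n} {A C : Subset n} → Disjoint A (C ∩ ∁ A)
Disjoint-∖ {A = A} {C} (x , x∈A∩B) =
  x∈∁p⇒x∉p (p∩q⊆q C (∁ A) (p∩q⊆q A (C ∩ ∁ A) x∈A∩B)) (p∩q⊆p A (C ∩ ∁ A) x∈A∩B)

⊆⇒≡∪∖ : ∀ {n} {A C : Subset n} → A ⊆ C → C ≡ A ∪ (C ∩ ∁ A)
⊆⇒≡∪∖ {A = A} {C} A⊆C = ⊆-antisym C⊆A∪B A∪B⊆C
  where
  C⊆A∪B : C ⊆ A ∪ (C ∩ ∁ A)
  C⊆A∪B {x} x∈C with x ∈? A
  ... | yes x∈A = p⊆p∪q (C ∩ ∁ A) x∈A
  ... | no  x∉A = q⊆p∪q A (C ∩ ∁ A) (x∈p∩q⁺ (x∈C , x∉p⇒x∈∁p x∉A))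
  A∪B⊆C : A ∪ (C ∩ ∁ A) ⊆ C
  A∪B⊆C x∈A∪B with x∈p∪q⁻ A (C ∩ ∁ A) x∈A∪B
  ... | inj₁ x∈A = A⊆C x∈A
  ... | inj₂ x∈B = p∩q⊆p C (∁ A) x∈B

∖-NonCrossing : ∀ {n} {𝓛 : Family n} {A C} → Laminar (asPred 𝓛) → A ∈F 𝓛 → C ∈F 𝓛 →
  (∀ D → D ∈F 𝓛 → A ⊆ D → D ⊆ C → D ⊆ A ⊎ C ⊆ D) →
  ∀ D → D ∈F 𝓛 → NonCrossing (C ∩ ∁ A) D
∖-NonCrossing {A = A} {C} laminar A∈𝓛 C∈𝓛 between D D∈𝓛 with laminar D C D∈𝓛 C∈𝓛
... | inj₁ D∩C=∅ = inj₁ λ (x , x∈B∩D) →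
  D∩C=∅ (x , x∈p∩q⁺ (p∩q⊆q (C ∩ ∁ A) D x∈B∩D , p∩q⊆p C (∁ A) (p∩q⊆p (C ∩ ∁ A) D x∈B∩D)))
... | inj₂ (inj₂ C⊆D) = inj₂ (inj₁ (C⊆D ∘ p∩q⊆p C (∁ A)))
... | inj₂ (inj₁ D⊆C) with laminar D A D∈𝓛 A∈𝓛
...   | inj₁ D∩A=∅ = inj₂ (inj₂ λ x∈D →
  x∈p∩q⁺ (D⊆C x∈D , x∉p⇒x∈∁p λ x∈A → D∩A=∅ (_ , x∈p∩q⁺ (x∈D , x∈A))))
...   | inj₂ (inj₁ D⊆A) = inj₁ (∖-Disjoint-⊆ D⊆A)
...   | inj₂ (inj₂ A⊆D) with between D D∈𝓛 A⊆D D⊆C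
...     | inj₁ D⊆A = inj₁ (∖-Disjoint-⊆ D⊆A)
...     | inj₂ C⊆D = inj₂ (inj₁ (C⊆D ∘ p∩q⊆p C (∁ A)))

d+2e≡4⇒d≡2 : ∀ {d e} → d + (e + e) ≡ 4 → 0 < e → d ≢ 0 → d ≡ 2
d+2e≡4⇒d≡2 {d} {1} d+2≡4 _ _ = +-cancelʳ-≡ 2 d 2 d+2≡4
d+2e≡4⇒d≡2 {zero} _ _ d≢0 = ⊥-elim (d≢0 refl)
d+2e≡4⇒d≡2 {suc d} {suc (suc e)} d+2e≡4 _ _ = contradiction d+2e≡4
  (>⇒≢ (+-mono-≤ {1} (s≤s z≤n) (+-mono-≤ {2} (s≤s (s≤s z≤n)) (s≤s (s≤s z≤n)))))

-- Maximal laminar subfamilies of 𝒞_G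

module _ {n : ℕ} .{{_ : NonZero n}} (π : Permutation′ (suc n)) (r : Fin (suc n)) where

  ⁅⁆∈CG : ∀ {v} → v ≢ r → InCG π r ⁅ v ⁆
  ⁅⁆∈CG {v} v≢r = (λ r∈⁅v⁆ → v≢r (sym (x∈⁅y⁆⇒x≡y v r∈⁅v⁆))) , δ-size-⁅⁆ π v

  ∁⁅r⁆∈CG : InCG π r (∁ ⁅ r ⁆)
  ∁⁅r⁆∈CG = x∈p⇒x∉∁p (x∈⁅x⁆ r) , trans (δ-size-∁ π ⁅ r ⁆) (δ-size-⁅⁆ π r)

  CG⇒Nonempty : ∀ {C} → InCG π r C → Nonempty C
  CG⇒Nonempty (_ , δ≡2) with δ-size≢0⇒boundary-vertex π (1+n≢0 ∘ trans (sym δ≡2))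
  ... | u , u∈C , _ = u , u∈C

  CG⇒⊆∁⁅r⁆ : ∀ {C} → InCG π r C → C ⊆ ∁ ⁅ r ⁆
  CG⇒⊆∁⁅r⁆ {C} (r∉C , _) {x} x∈C =
    x∉p⇒x∈∁p λ x∈⁅r⁆ → r∉C (subst (_∈ C) (x∈⁅y⁆⇒x≡y r x∈⁅r⁆) x∈C)

  maximal-closed : ∀ {𝓛 C} → MaximalLaminar π r 𝓛 → InCG π r C →
    (∀ D → D ∈F 𝓛 → NonCrossing C D) → C ∈F 𝓛
  maximal-closed {𝓛} {C} (_ , laminar , unextendable) C∈CG noncrossing =
    decidable-stable (𝓛 C Bool.≟ true) λ C∉𝓛 →
      unextendable C C∈CG C∉𝓛 (Laminar-addTo laminar noncrossing)

  maximal⇒Cond1 : ∀ {𝓛} → MaximalLaminar π r 𝓛 → Cond1 r 𝓛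
  maximal⇒Cond1 maximal v v≢r = maximal-closed maximal (⁅⁆∈CG v≢r) (λ D _ → ⁅⁆-NonCrossing v D)

  maximal⇒Cond2 : ∀ {𝓛} → MaximalLaminar π r 𝓛 → Cond2 r 𝓛
  maximal⇒Cond2 maximal@(subfamily , _) =
    maximal-closed maximal ∁⁅r⁆∈CG (λ D D∈𝓛 → inj₂ (inj₂ (CG⇒⊆∁⁅r⁆ (subfamily D D∈𝓛))))

  maximal⇒Cond3 : ∀ {𝓛} → MaximalLaminar π r 𝓛 → Cond3 𝓛
  maximal⇒Cond3 {𝓛} maximal@(subfamily , laminar , _) C C∈𝓛 1<∣C∣ with subfamily C C∈𝓛
  ... | r∉C , δC≡2 with δ-size≢0⇒boundary-vertex π (1+n≢0 ∘ trans (sym δC≡2))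
  ... | u , u∈C , leaves-C-from
    with ⊂-maximal (λ D → (𝓛 D Bool.≟ true) ×-dec (u ∈? D) ×-dec (D ⊂? C))
                   ( maximal⇒Cond1 maximal u (λ { refl → r∉C u∈C })
                   , x∈⁅x⁆ u , x∈p∧1<∣p∣⇒⁅x⁆⊂p u∈C 1<∣C∣)
  ... | A , (A∈𝓛 , u∈A , A⊆C , x , x∈C , x∉A) , A-maximal =
    A , C ∩ ∁ A , A∈𝓛 , B∈𝓛 , Disjoint-∖ , ⊆⇒≡∪∖ A⊆C
    where
    between : ∀ D → D ∈F 𝓛 → A ⊆ D → D ⊆ C → D ⊆ A ⊎ C ⊆ D
    between D D∈𝓛 A⊆D D⊆C with D ⊂? C
    ... | yes D⊂C = inj₁ (⊆∧⊄⇒⊇ A⊆D (A-maximal D (D∈𝓛 , A⊆D u∈A , D⊂C)))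
    ... | no  D⊄C = inj₂ (⊆∧⊄⇒⊇ D⊆C D⊄C)
    r∉B : r ∉ C ∩ ∁ A
    r∉B = r∉C ∘ p∩q⊆p C (∁ A)
    δB≡2 : δ-size π (C ∩ ∁ A) ≡ 2
    δB≡2 = d+2e≡4⇒d≡2
      (trans (δ-size-difference π A⊆C) (cong₂ _+_ δC≡2 (proj₂ (subfamily A A∈𝓛))))
      (leaves-C-from A u∈A)
      (∈∧∉⇒δ-size≢0 π (x∈p∩q⁺ (x∈C , x∉p⇒x∈∁p x∉A)) r∉B)
    B∈𝓛 : (C ∩ ∁ A) ∈F 𝓛
    B∈𝓛 = maximal-closed maximal (r∉B , δB≡2) (∖-NonCrossing laminar A∈𝓛 C∈𝓛 between)

  Cond2∧Cond3⇒unextendable : ∀ {𝓛} → SubfamilyOfCG π r 𝓛 → Cond2 r 𝓛 → Cond3 𝓛 →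
    ∀ C → InCG π r C → ¬ C ∈F 𝓛 → ¬ Laminar (addTo 𝓛 C)
  Cond2∧Cond3⇒unextendable subfamily cond2 cond3 C C∈CG C∉𝓛 laminar+C = C∉𝓛
    (splitting⇒closed (λ D → CG⇒Nonempty ∘ subfamily D) cond3 (CG⇒Nonempty C∈CG)
      (λ D D∈𝓛 → laminar+C C D (inj₂ refl) (inj₁ D∈𝓛)) cond2 (CG⇒⊆∁⁅r⁆ C∈CG))

lemma31 : (n : ℕ) → 3 ≤ suc n → (π : Permutation′ (suc n)) → (r : Fin (suc n))
    → (𝓛 : Family (suc n)) → SubfamilyOfCG π r 𝓛
    → MaximalLaminar π r 𝓛 ⇔ (Laminar (asPred 𝓛) × Cond1 r 𝓛 × Cond2 r 𝓛 × Cond3 𝓛)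
lemma31 zero (s≤s ())
lemma31 (suc n) _ π r 𝓛 subfamily = mk⇔
  (λ maximal@(_ , laminar , _) →
    laminar , maximal⇒Cond1 π r maximal , maximal⇒Cond2 π r maximal , maximal⇒Cond3 π r maximal)
  (λ (laminar , _ , cond2 , cond3) →
    subfamily , laminar , Cond2∧Cond3⇒unextendable π r subfamily cond2 cond3)
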